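{- Let $A$ be a game, $\sigma$ a strategy on $A$, and $\mathsf x_A$ a complete symmetry class of $A$ with chosen canonical representative $\hat{\mathsf x}_A$. Define $W_1=\{(x^\sigma,\theta)\mid x^\sigma\ +\text{ -covered in }\sigma,\ \partial_\sigma(x^\sigma)\cong^+_A\hat{\mathsf x}_A,\ \theta:\partial_\sigma(x^\sigma)\cong_A\hat{\mathsf x}_A\}$, $W_2=\{(x^\sigma,\theta^+)\mid x^\sigma\ +\text{ -covered in }\sigma,\ \theta^+:\partial_\sigma(x^\sigma)\cong^+_A\hat{\mathsf x}_A\}$, and let $N$ be the set of negative symmetries $\hat{\mathsf x}_A\cong^-_A\hat{\mathsf x}_A$. Then there is a bijection $W_1\simeq N\times W_2$.
   Context: Event structures: countable set of events, partial order $\le$ with finite down-sets, irreflexive symmetric conflict $\#$ with $e_1\#e_2\le e_2'\Rightarrow e_1\#e_2'$; configurations are finite down-closed conflict-free sets ($\mathscr C(E)$); $\rightarrow$ is immediate causality. An isomorphism family $\tilde E$: bijections between configurations, containing identities, closed under composition and inverse, each with a unique restriction to any sub-configuration of its domain and some extension to any configuration containing its domain; $\theta:x\cong_Ey$. A tcg $A$: such a structure with symmetry-preserved polarity $\mathrm{pol}_A$ and subfamilies $\tilde A_+,\tilde A_-$ (positive/negative symmetries, $\cong^\pm_A$) meeting only in identities, each closed within $\tilde A$ under extension by pairs of events of its own polarity. A game adds a symmetry-invariant payoff $\kappa_A:\mathscr C(A)\to\{ -1,0,+1\}$ (payoff $0$: complete) and a chosen canonical representative $\hat{\mathsf x}\in\mathsf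 x$ of each complete symmetry class $\mathsf x$, where $x$ is canonical if each $\theta:x\cong_Ax$ factors uniquely as $\theta^+\circ\theta^-$ with $\theta^-:x\cong^-_Ax$, $\theta^+:x\cong^+_Ax$. A strategy on a game $A$ is an event structure with symmetry $(\sigma,\tilde\sigma)$ with display $\partial_\sigma:|\sigma|\to|A|$ mapping configurations to configurations, injective on configurations, mapping symmetries to symmetries, and: ($\sim$-receptive) for $\theta:x\cong_\sigma y$, $x\cup\{s_1\}\in\mathscr C(\sigma)$ with $s_1$ negative and $\partial\theta\cup\{(\partial s_1,a_2)\}\in\tilde A$ there is a unique $s_2$ with $\theta\cup\{(s_1,s_2)\}\in\tilde\sigma$, $\partial s_2=a_2$; (thin) for $\theta:x\cong_\sigma y$ and $x\cup\{s_1\}\in\mathscr C(\sigma)$ with $s_1$ positive there is a unique $s_2$ with $y\cup\{s_2\}\in\mathscr C(\sigma)$ and $\theta\cup\{(s_1,s_2)\}\in\tilde\sigma$; minimal events negative; (courteous) $s_1\rightarrow s_2$ with $s_1$ positive or $s_2$ negative implies $\partial s_1\rightarrow\partial s_2$; (receptive) for $x\in\mathscr C(\sigma)$ and negative $a\notin\partial x$ with $\partial x\cup\{a\}\in\mathscr C(A)$ there is a unique $s$ with $x\cup\{s\}\in\mathscr C(\sigma)$, $\partial s=a$. Events have the polarity of their display; a configuration is $+$-covered if its maximal events are positive. -}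

module Defs where

open import Level using (0ℓ) renaming (suc to lsuc)
open import Data.Nat using (ℕ)
open import Data.List using (List)
open import Data.List.Membership.Propositional using (_∈_)
open import Data.Product using (Σ; Σ-syntax; ∃; ∃₂; ∃!; _×_; _,_; proj₁; proj₂)
open import Data.Product.Relation.Binary.Pointwise.NonDependent using (×-setoid)
open import Data.Sum using (_⊎_; inj₁; inj₂)
open import Relation.Nullary using (¬_)
open import Relation.Binary.PropositionalEquality using (_≡_; _≢_; refl)
open import Relation.Binary.Bundles using (Setoid)
open import Function.Bundles using (Inverse)

Subset : Set → Set₁
Subset X = X → Set

PairSet : Set → Set₁
PairSet X = X → X → Set

module _ {X : Set} where

  _⊆_ : Subset X → Subset X → Set
  x ⊆ y = ∀ {e} → x e → y e

  _≐_ : Subset X → Subset X → Set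
  x ≐ y = (x ⊆ y) × (y ⊆ x)

  _∪｛_｝ : Subset X → X → Subset X
  (x ∪｛ e ｝) e' = x e' ⊎ e' ≡ e

  _⊆₂_ : PairSet X → PairSet X → Set
  θ ⊆₂ ψ = ∀ {a b} → θ a b → ψ a b

  _≐₂_ : PairSet X → PairSet X → Set
  θ ≐₂ ψ = (θ ⊆₂ ψ) × (ψ ⊆₂ θ)

  _∪⟨_↦_⟩ : PairSet X → X → X → PairSet X
  (θ ∪⟨ a ↦ b ⟩) a' b' = θ a' b' ⊎ (a' ≡ a × b' ≡ b)

  idP : Subset X → PairSet X
  idP x a b = x a × a ≡ b

  _∘P_ : PairSet X → PairSet X → PairSet X
  (ψ ∘P θ) a c = ∃ λ b → θ a b × ψ b c

  invP : PairSet X → PairSet X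
  invP θ a b = θ b a

  record IsBij (θ : PairSet X) (x y : Subset X) : Set where
    field
      dom        : ∀ {a b} → θ a b → x a
      cod        : ∀ {a b} → θ a b → y b
      total      : ∀ {a} → x a → ∃ λ b → θ a b
      surjective : ∀ {b} → y b → ∃ λ a → θ a b
      functional : ∀ {a b b'} → θ a b → θ a b' → b ≡ b'
      injective  : ∀ {a a' b} → θ a b → θ a' b → a ≡ a'


image : {X Y : Set} → (X → Y) → Subset X → Subset Y
image f x a = ∃ λ s → x s × f s ≡ a

imageP : {X Y : Set} → (X → Y) → PairSet X → PairSet Y
imageP f θ a b = ∃₂ λ s t → θ s t × f s ≡ a × f t ≡ b

record EventStructure : Set₁ where
  field
    Ev        : Set
    -- countable set of events
    code      : Ev → ℕ
    code-inj  : ∀ {e e'} → code e ≡ code e' → e ≡ e'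
    _≤_       : Ev → Ev → Set
    ≤-refl    : ∀ {e} → e ≤ e
    ≤-trans   : ∀ {e e' e''} → e ≤ e' → e' ≤ e'' → e ≤ e''
    ≤-antisym : ∀ {e e'} → e ≤ e' → e' ≤ e → e ≡ e'
    ≤-finite  : ∀ e → ∃ λ (l : List Ev) → ∀ {e'} → e' ≤ e → e' ∈ l
    _#_       : Ev → Ev → Set
    #-irrefl  : ∀ {e} → ¬ (e # e)
    #-sym     : ∀ {e e'} → e # e' → e' # e
    #-inh     : ∀ {e₁ e₂ e₂'} → e₁ # e₂ → e₂ ≤ e₂' → e₁ # e₂'

module _ (E : EventStructure) where
  open EventStructure E

  ImmCause : Ev → Ev → Set
  ImmCause e e' = (e ≤ e' × e ≢ e')
                × (∀ e'' → e ≤ e'' → e'' ≤ e' → e'' ≡ e ⊎ e'' ≡ e')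

  Minimal : Ev → Set
  Minimal e = ∀ {e'} → e' ≤ e → e' ≡ e

  record IsConfig (x : Subset Ev) : Set where
    field
      finite        : ∃ λ (l : List Ev) → ∀ {e} → x e → e ∈ l
      down-closed   : ∀ {e e'} → e' ≤ e → x e → x e'
      conflict-free : ∀ {e e'} → x e → x e' → ¬ (e # e')

  Config : Set₁
  Config = Σ (Subset Ev) IsConfig

  -- a family of bijections between configurations:  S x y θ  means  θ : x ≅ y  in the family
  Family : Set₁
  Family = Subset Ev → Subset Ev → PairSet Ev → Set


  record IsIsoFamily (S : Family) : Set₁ where
    field
      bij     : ∀ {x y θ} → S x y θ → IsConfig x × IsConfig y × IsBij θ x y
      -- extensionality (sets are compared by their elements)
      resp    : ∀ {x y θ x' y' θ'} → S x y θ → x ≐ x' → y ≐ y' → θ ≐₂ θ' → S x' y' θ'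
      ident   : ∀ {x} → IsConfig x → S x x (idP x)
      comp    : ∀ {x y z θ ψ} → S x y θ → S y z ψ → S x z (ψ ∘P θ)
      inverse : ∀ {x y θ} → S x y θ → S y x (invP θ)
      restrict : ∀ {x y θ x'} → S x y θ → IsConfig x' → x' ⊆ x →
                 Σ[ θ' ∈ PairSet Ev ] Σ[ y' ∈ Subset Ev ] (S x' y' θ' × θ' ⊆₂ θ)
      restrict-unique : ∀ {x y θ x' y₁ y₂ θ₁ θ₂} → S x y θ →
                 S x' y₁ θ₁ → θ₁ ⊆₂ θ → S x' y₂ θ₂ → θ₂ ⊆₂ θ → θ₁ ≐₂ θ₂
      extend  : ∀ {x y θ x'} → S x y θ → IsConfig x' → x ⊆ x' →
                 Σ[ θ' ∈ PairSet Ev ] Σ[ y' ∈ Subset Ev ] (S x' y' θ' × θ ⊆₂ θ')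

InFam : (E : EventStructure) → Family E → PairSet (EventStructure.Ev E) → Set₁
InFam E S θ = ∃₂ λ x y → S x y θ

data Pol : Set where
  plus minus : Pol

module _ (E : EventStructure) where
  open EventStructure E

  record IsTCG (Sym Sym⁺ Sym⁻ : Family E) (pol : Ev → Pol) : Set₁ where
    field
      isFam    : IsIsoFamily E Sym
      pol-sym  : ∀ {x y θ a b} → Sym x y θ → θ a b → pol a ≡ pol b
      isFam⁺   : IsIsoFamily E Sym⁺
      isFam⁻   : IsIsoFamily E Sym⁻
      sub⁺     : ∀ {x y θ} → Sym⁺ x y θ → Sym x y θ
      sub⁻     : ∀ {x y θ} → Sym⁻ x y θ → Sym x y θ
      meet     : ∀ {x y θ} → Sym⁺ x y θ → Sym⁻ x y θ → θ ≐₂ idP x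
      ext⁺     : ∀ {x y θ x' y' θ'} → Sym⁺ x y θ → Sym x' y' θ' → θ ⊆₂ θ' →
                 (∀ {a b} → θ' a b → ¬ θ a b → pol a ≡ plus) → Sym⁺ x' y' θ'
      ext⁻     : ∀ {x y θ x' y' θ'} → Sym⁻ x y θ → Sym x' y' θ' → θ ⊆₂ θ' →
                 (∀ {a b} → θ' a b → ¬ θ a b → pol a ≡ minus) → Sym⁻ x' y' θ'

  IsCanonical : (Sym Sym⁺ Sym⁻ : Family E) → Subset Ev → Set₁
  IsCanonical Sym Sym⁺ Sym⁻ x =
    ∀ {θ} → Sym x x θ →
      Σ[ θ⁻ ∈ PairSet Ev ] Σ[ θ⁺ ∈ PairSet Ev ]
        ((Sym⁻ x x θ⁻ × Sym⁺ x x θ⁺ × θ ≐₂ (θ⁺ ∘P θ⁻))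
        × (∀ {φ⁻ φ⁺} → Sym⁻ x x φ⁻ → Sym⁺ x x φ⁺ → θ ≐₂ (φ⁺ ∘P φ⁻) →
             (φ⁻ ≐₂ θ⁻) × (φ⁺ ≐₂ θ⁺)))

data Payoff : Set where
  -1ₚ 0ₚ +1ₚ : Payoff

record Game : Set₁ where
  field
    E     : EventStructure
  open EventStructure E public
  field
    Sym   : Family E
    Sym⁺  : Family E
    Sym⁻  : Family E
    pol   : Ev → Pol
    isTCG : IsTCG E Sym Sym⁺ Sym⁻ pol
    κ     : Config E → Payoff
    κ-sym : ∀ {x y θ} (cx : IsConfig E x) (cy : IsConfig E y) →
            Sym x y θ → κ (x , cx) ≡ κ (y , cy)
    -- chosen canonical representative of each complete symmetry class
    -- (a choice function on complete configurations, constant on classes)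
    canon       : (x : Config E) → κ x ≡ 0ₚ → Subset Ev
    canon-class : ∀ x c → ∃ λ θ → Sym (proj₁ x) (canon x c) θ
    canon-inv   : ∀ {x y} c c' {θ} → Sym (proj₁ x) (proj₁ y) θ → canon x c ≐ canon y c'
    canon-canonical : ∀ x c → IsCanonical E Sym Sym⁺ Sym⁻ (canon x c)

module _ (A : Game) where
  private module A = Game A

  record Strategy : Set₁ where
    field
      S      : EventStructure
    open EventStructure S renaming (Ev to EvS; _≤_ to _≤S_)
    field
      SymS   : Family S
      isFamS : IsIsoFamily S SymS
      ∂      : EvS → A.Ev
      ∂-config : ∀ {x} → IsConfig S x → IsConfig A.E (image ∂ x)
      ∂-inj    : ∀ {x} → IsConfig S x → ∀ {s s'} → x s → x s' → ∂ s ≡ ∂ s' → s ≡ s'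
      ∂-sym    : ∀ {x y θ} → SymS x y θ → A.Sym (image ∂ x) (image ∂ y) (imageP ∂ θ)
    polS : EvS → Pol
    polS s = A.pol (∂ s)
    field
      ~-receptive : ∀ {x y θ s₁ a₂} → SymS x y θ → IsConfig S (x ∪｛ s₁ ｝) → ¬ x s₁ →
                    polS s₁ ≡ minus → InFam A.E A.Sym (imageP ∂ θ ∪⟨ ∂ s₁ ↦ a₂ ⟩) →
                    ∃! _≡_ (λ s₂ → InFam S SymS (θ ∪⟨ s₁ ↦ s₂ ⟩) × ∂ s₂ ≡ a₂)
      thin        : ∀ {x y θ s₁} → SymS x y θ → IsConfig S (x ∪｛ s₁ ｝) → ¬ x s₁ →
                    polS s₁ ≡ plus →
                    ∃! _≡_ (λ s₂ → IsConfig S (y ∪｛ s₂ ｝) × InFam S SymS (θ ∪⟨ s₁ ↦ s₂ ⟩))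
      minimal-neg : ∀ {s} → Minimal S s → polS s ≡ minus
      courteous   : ∀ {s₁ s₂} → ImmCause S s₁ s₂ → (polS s₁ ≡ plus ⊎ polS s₂ ≡ minus) →
                    ImmCause A.E (∂ s₁) (∂ s₂)
      receptive   : ∀ {x a} → IsConfig S x → A.pol a ≡ minus → ¬ image ∂ x a →
                    IsConfig A.E (image ∂ x ∪｛ a ｝) →
                    ∃! _≡_ (λ s → IsConfig S (x ∪｛ s ｝) × ∂ s ≡ a)

    PlusCovered : Subset EvS → Set
    PlusCovered x = IsConfig S x ×
      (∀ {s} → x s → (∀ {s'} → x s' → s ≤S s' → s' ≡ s) → polS s ≡ plus)

module _ (A : Game) (σ : Strategy A) (x̂ : Subset (Game.Ev A)) where
  private module A = Game A
  open Strategy σ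

  record W₁El : Set₁ where
    constructor w₁
    field
      xσ     : Subset (EventStructure.Ev S)
      covered : PlusCovered xσ
      pos     : ∃ λ φ → A.Sym⁺ (image ∂ xσ) x̂ φ
      θ       : PairSet A.Ev
      θ-sym   : A.Sym (image ∂ xσ) x̂ θ

  record W₂El : Set₁ where
    constructor w₂
    field
      xσ      : Subset (EventStructure.Ev S)
      covered : PlusCovered xσ
      θ⁺      : PairSet A.Ev
      θ⁺-sym  : A.Sym⁺ (image ∂ xσ) x̂ θ⁺

  record NEl : Set₁ where
    constructor nel
    field
      θ⁻     : PairSet A.Ev
      θ⁻-sym : A.Sym⁻ x̂ x̂ θ⁻

  private
    ⊆-refl : {X : Set} {x : Subset X} → x ⊆ x
    ⊆-refl p = p
    ≐-refl : {X : Set} {x : Subset X} → x ≐ x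
    ≐-refl = (λ p → p) , (λ p → p)
    ≐-sym : {X : Set} {x y : Subset X} → x ≐ y → y ≐ x
    ≐-sym (p , q) = q , p
    ≐-trans : {X : Set} {x y z : Subset X} → x ≐ y → y ≐ z → x ≐ z
    ≐-trans (p , q) (p' , q') = (λ r → p' (p r)) , (λ r → q (q' r))
    ≐₂-refl : {X : Set} {θ : PairSet X} → θ ≐₂ θ
    ≐₂-refl = (λ p → p) , (λ p → p)
    ≐₂-sym : {X : Set} {θ ψ : PairSet X} → θ ≐₂ ψ → ψ ≐₂ θ
    ≐₂-sym (p , q) = q , p
    ≐₂-trans : {X : Set} {θ ψ χ : PairSet X} → θ ≐₂ ψ → ψ ≐₂ χ → θ ≐₂ χ
    ≐₂-trans (p , q) (p' , q') = (λ r → p' (p r)) , (λ r → q (q' r))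

  W₁ : Setoid (lsuc 0ℓ) 0ℓ
  W₁ = record
    { Carrier = W₁El
    ; _≈_ = λ u v → (W₁El.xσ u ≐ W₁El.xσ v) × (W₁El.θ u ≐₂ W₁El.θ v)
    ; isEquivalence = record
      { refl = λ {u} → ≐-refl {x = W₁El.xσ u} , ≐₂-refl {θ = W₁El.θ u}
      ; sym = λ (p , q) → ≐-sym p , ≐₂-sym q
      ; trans = λ (p , q) (p' , q') → ≐-trans p p' , ≐₂-trans q q' } }

  W₂ : Setoid (lsuc 0ℓ) 0ℓ
  W₂ = record
    { Carrier = W₂El
    ; _≈_ = λ u v → (W₂El.xσ u ≐ W₂El.xσ v) × (W₂El.θ⁺ u ≐₂ W₂El.θ⁺ v)
    ; isEquivalence = record
      { refl = λ {u} → ≐-refl {x = W₂El.xσ u} , ≐₂-refl {θ = W₂El.θ⁺ u}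
      ; sym = λ (p , q) → ≐-sym p , ≐₂-sym q
      ; trans = λ (p , q) (p' , q') → ≐-trans p p' , ≐₂-trans q q' } }

  N : Setoid (lsuc 0ℓ) 0ℓ
  N = record
    { Carrier = NEl
    ; _≈_ = λ u v → NEl.θ⁻ u ≐₂ NEl.θ⁻ v
    ; isEquivalence = record { refl = λ {u} → ≐₂-refl {θ = NEl.θ⁻ u} ; sym = ≐₂-sym ; trans = ≐₂-trans } }

  N×W₂ : Setoid (lsuc 0ℓ) 0ℓ
  N×W₂ = ×-setoid N W₂

{-# OPTIONS --safe #-}
module Submission where

-- For a configuration y with some positive symmetry φ : y ≅⁺ x̂, every θ : y ≅ x̂ factors
-- uniquely as θ⁻ ∘ θ⁺ with θ⁺ : y ≅⁺ x̂ and θ⁻ : x̂ ≅⁻ x̂. Both halves come from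
-- canonicity of x̂ applied to the endo-symmetry φ ∘ θ⁻¹ of x̂: its factorisation ψ⁺ ∘ ψ⁻
-- yields θ = ψ⁻⁻¹ ∘ (ψ⁺⁻¹ ∘ φ), and the uniqueness of that factorisation forces θ⁻.
-- The map (xσ , θ) ↦ (θ⁻ , (xσ , θ⁺)) is then the bijection W₁ ≃ N × W₂.

open import Defs
open import Level using (0ℓ)
open import Data.Product using (_,_; _×_; proj₁; proj₂)
open import Relation.Binary.PropositionalEquality using (_≡_; refl)
open import Relation.Binary.Bundles using (Setoid)
open import Function.Bundles using (Inverse)

module _ {X : Set} where

  ≐-refl : {x : Subset X} → x ≐ x
  ≐-refl = (λ p → p) , (λ p → p)

  ≐-sym : {x y : Subset X} → x ≐ y → y ≐ x
  ≐-sym (p , q) = q , p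

  ≐₂-setoid : Setoid _ 0ℓ
  ≐₂-setoid = record
    { Carrier = PairSet X
    ; _≈_ = _≐₂_
    ; isEquivalence = record
      { refl = (λ p → p) , (λ p → p)
      ; sym = λ (p , q) → q , p
      ; trans = λ (p , q) (p′ , q′) → (λ r → p′ (p r)) , (λ r → q (q′ r)) } }

  open Setoid ≐₂-setoid public
    using () renaming (refl to ≐₂-refl; sym to ≐₂-sym; trans to ≐₂-trans)

  invP-cong : {θ ψ : PairSet X} → θ ≐₂ ψ → invP θ ≐₂ invP ψ
  invP-cong (p , q) = p , q

  ∘P-cong : {θ θ′ ψ ψ′ : PairSet X} → ψ ≐₂ ψ′ → θ ≐₂ θ′ → (ψ ∘P θ) ≐₂ (ψ′ ∘P θ′)
  ∘P-cong (p , p′) (q , q′) = (λ (b , t , s) → b , q t , p s) , (λ (b , t , s) → b , q′ t , p′ s)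

  ∘P-assoc : {θ ψ χ : PairSet X} → ((χ ∘P ψ) ∘P θ) ≐₂ (χ ∘P (ψ ∘P θ))
  ∘P-assoc = (λ (b , t , c , s , r) → c , (b , t , s) , r)
           , (λ (c , (b , t , s) , r) → b , t , c , s , r)

  invP-∘P : {θ ψ : PairSet X} → invP (ψ ∘P θ) ≐₂ (invP θ ∘P invP ψ)
  invP-∘P = (λ (b , t , s) → b , s , t) , (λ (b , s , t) → b , t , s)

  ∘P-identityˡ : {θ : PairSet X} {y : Subset X} → (∀ {a b} → θ a b → y b) →
                 (idP y ∘P θ) ≐₂ θ
  ∘P-identityˡ cod = (λ { (b , t , _ , refl) → t }) , (λ t → _ , t , cod t , refl)

  ∘P-identityʳ : {θ : PairSet X} {x : Subset X} → (∀ {a b} → θ a b → x a) →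
                 (θ ∘P idP x) ≐₂ θ
  ∘P-identityʳ dom = (λ { (b , (_ , refl) , t) → t }) , (λ t → _ , (dom t , refl) , t)

  invP-inverseˡ : {θ : PairSet X} {x y : Subset X} → IsBij θ x y → (invP θ ∘P θ) ≐₂ idP x
  invP-inverseˡ θ-bij =
      (λ (b , t , s) → IsBij.dom θ-bij t , IsBij.injective θ-bij t s)
    , (λ { (xa , refl) → let (b , t) = IsBij.total θ-bij xa in b , t , t })

image-cong : {X Y : Set} (f : X → Y) {x x′ : Subset X} → x ≐ x′ → image f x ≐ image f x′
image-cong f (p , q) = (λ (s , xs , e) → s , p xs , e) , (λ (s , xs , e) → s , q xs , e)

module NegPosFactorisation
  {E : EventStructure} {Sym Sym⁺ Sym⁻ : Family E} {pol : EventStructure.Ev E → Pol}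
  (tcg : IsTCG E Sym Sym⁺ Sym⁻ pol)
  {x̂ : Subset (EventStructure.Ev E)} (canonical : IsCanonical E Sym Sym⁺ Sym⁻ x̂) where

  open EventStructure E using (Ev)
  open IsTCG tcg
  open import Relation.Binary.Reasoning.Setoid (≐₂-setoid {Ev})
  private
    module F = IsIsoFamily isFam
    module F⁺ = IsIsoFamily isFam⁺
    module F⁻ = IsIsoFamily isFam⁻

  bij : ∀ {x y θ} → Sym x y θ → IsBij θ x y
  bij θ-sym = proj₂ (proj₂ (F.bij θ-sym))

  record Factorisation (y : Subset Ev) (θ : PairSet Ev) : Set₁ where
    field
      θ⁻      : PairSet Ev
      θ⁺      : PairSet Ev
      θ⁻-sym  : Sym⁻ x̂ x̂ θ⁻
      θ⁺-sym  : Sym⁺ y x̂ θ⁺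
      factors : θ ≐₂ (θ⁻ ∘P θ⁺)

  open Factorisation

  factorisation-resp : ∀ {y y′ θ θ′} → y ≐ y′ → θ ≐₂ θ′ → Factorisation y θ → Factorisation y′ θ′
  factorisation-resp y≐y′ θ≐θ′ f = record
    { θ⁻ = θ⁻ f ; θ⁺ = θ⁺ f ; θ⁻-sym = θ⁻-sym f
    ; θ⁺-sym = F⁺.resp (θ⁺-sym f) y≐y′ ≐-refl ≐₂-refl
    ; factors = ≐₂-trans (≐₂-sym θ≐θ′) (factors f) }

  factorise : ∀ {y θ φ} → Sym y x̂ θ → Sym⁺ y x̂ φ → Factorisation y θ
  factorise {y} {θ} {φ} θ-sym φ-sym with canonical (F.comp (F.inverse θ-sym) (sub⁺ φ-sym))
  ... | ψ⁻ , ψ⁺ , (ψ⁻-sym , ψ⁺-sym , φθ⁻¹≐) , _ = record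
    { θ⁻ = invP ψ⁻ ; θ⁺ = invP ψ⁺ ∘P φ
    ; θ⁻-sym = F⁻.inverse ψ⁻-sym ; θ⁺-sym = F⁺.comp φ-sym (F⁺.inverse ψ⁺-sym)
    ; factors = θ≐ }
    where
      θ≐ : θ ≐₂ (invP ψ⁻ ∘P (invP ψ⁺ ∘P φ))
      θ≐ = begin
        θ                               ≈⟨ ∘P-identityʳ (IsBij.dom (bij θ-sym)) ⟨
        θ ∘P idP y                      ≈⟨ ∘P-cong ≐₂-refl (invP-inverseˡ (bij (sub⁺ φ-sym))) ⟨
        θ ∘P (invP φ ∘P φ)              ≈⟨ ∘P-assoc ⟨
        (θ ∘P invP φ) ∘P φ              ≈⟨ ∘P-cong invP-∘P ≐₂-refl ⟨
        invP (φ ∘P invP θ) ∘P φ         ≈⟨ ∘P-cong (invP-cong φθ⁻¹≐) ≐₂-refl ⟩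
        invP (ψ⁺ ∘P ψ⁻) ∘P φ            ≈⟨ ∘P-cong invP-∘P ≐₂-refl ⟩
        (invP ψ⁻ ∘P invP ψ⁺) ∘P φ       ≈⟨ ∘P-assoc ⟩
        invP ψ⁻ ∘P (invP ψ⁺ ∘P φ)       ∎

  θ⁺-solve : ∀ {y θ} (f : Factorisation y θ) → θ⁺ f ≐₂ (invP (θ⁻ f) ∘P θ)
  θ⁺-solve {θ = θ} f = begin
    θ⁺ f                                    ≈⟨ ∘P-identityˡ (IsBij.cod (bij (sub⁺ (θ⁺-sym f)))) ⟨
    idP x̂ ∘P θ⁺ f                           ≈⟨ ∘P-cong (invP-inverseˡ (bij (sub⁻ (θ⁻-sym f)))) ≐₂-refl ⟨
    (invP (θ⁻ f) ∘P θ⁻ f) ∘P θ⁺ f           ≈⟨ ∘P-assoc ⟩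
    invP (θ⁻ f) ∘P (θ⁻ f ∘P θ⁺ f)           ≈⟨ ∘P-cong ≐₂-refl (factors f) ⟨
    invP (θ⁻ f) ∘P θ                        ∎

  -- For π = θ⁺ f, every factorisation θ = θ⁻ ∘ θ⁺ splits the endo-symmetry π ∘ θ⁻¹ of x̂
  -- as (π ∘ θ⁺⁻¹) ∘ θ⁻⁻¹, so canonicity of x̂ pins θ⁻ down; θ⁺ = θ⁻⁻¹ ∘ θ follows.
  factorisation-unique : ∀ {y θ} → Sym y x̂ θ → (f g : Factorisation y θ) →
                         (θ⁻ f ≐₂ θ⁻ g) × (θ⁺ f ≐₂ θ⁺ g)
  factorisation-unique {y} {θ} θ-sym f g
    with canonical (F.comp (F.inverse θ-sym) (sub⁺ (θ⁺-sym f)))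
  ... | ψ⁻ , _ , _ , unique =
      θ⁻f≐θ⁻g
    , ≐₂-trans (θ⁺-solve f) (≐₂-trans (∘P-cong (invP-cong θ⁻f≐θ⁻g) ≐₂-refl) (≐₂-sym (θ⁺-solve g)))
    where
      π : PairSet Ev
      π = θ⁺ f
      πθ⁻¹-split : (h : Factorisation y θ) → (π ∘P invP θ) ≐₂ ((π ∘P invP (θ⁺ h)) ∘P invP (θ⁻ h))
      πθ⁻¹-split h = begin
        π ∘P invP θ                                ≈⟨ ∘P-cong ≐₂-refl (invP-cong (factors h)) ⟩
        π ∘P invP (θ⁻ h ∘P θ⁺ h)                   ≈⟨ ∘P-cong ≐₂-refl invP-∘P ⟩
        π ∘P (invP (θ⁺ h) ∘P invP (θ⁻ h))          ≈⟨ ∘P-assoc ⟨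
        (π ∘P invP (θ⁺ h)) ∘P invP (θ⁻ h)          ∎
      negative-part : (h : Factorisation y θ) → invP (θ⁻ h) ≐₂ ψ⁻
      negative-part h = proj₁ (unique (F⁻.inverse (θ⁻-sym h))
                                      (F⁺.comp (F⁺.inverse (θ⁺-sym h)) (θ⁺-sym f))
                                      (πθ⁻¹-split h))
      θ⁻f≐θ⁻g : θ⁻ f ≐₂ θ⁻ g
      θ⁻f≐θ⁻g = invP-cong (≐₂-trans (negative-part f) (≐₂-sym (negative-part g)))

module _ (A : Game) (σ : Strategy A) {x̂ : Subset (Game.Ev A)}
         (canonical : IsCanonical (Game.E A) (Game.Sym A) (Game.Sym⁺ A) (Game.Sym⁻ A) x̂) where

  open Game A using (isTCG)
  open IsTCG isTCG using (isFam; sub⁺; sub⁻)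
  open IsIsoFamily isFam using (comp)
  open Strategy σ using (∂)
  open NegPosFactorisation isTCG canonical
  open Factorisation

  private
    _≈₁_ = Setoid._≈_ (W₁ A σ x̂)
    _≈₂_ = Setoid._≈_ (N×W₂ A σ x̂)

  factorisationOf : (u : W₁El A σ x̂) → Factorisation (image ∂ (W₁El.xσ u)) (W₁El.θ u)
  factorisationOf (w₁ _ _ (_ , φ-sym) _ θ-sym) = factorise θ-sym φ-sym

  split : W₁El A σ x̂ → NEl A σ x̂ × W₂El A σ x̂
  split u = nel (θ⁻ f) (θ⁻-sym f) , w₂ (W₁El.xσ u) (W₁El.covered u) (θ⁺ f) (θ⁺-sym f)
    where f = factorisationOf u

  join : NEl A σ x̂ × W₂El A σ x̂ → W₁El A σ x̂
  join (nel θ⁻ θ⁻-sym , w₂ xσ covered θ⁺ θ⁺-sym) =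
    w₁ xσ covered (θ⁺ , θ⁺-sym) (θ⁻ ∘P θ⁺) (comp (sub⁺ θ⁺-sym) (sub⁻ θ⁻-sym))

  joined : (v : NEl A σ x̂ × W₂El A σ x̂) →
           Factorisation (image ∂ (W₂El.xσ (proj₂ v))) (W₁El.θ (join v))
  joined (nel θ⁻ θ⁻-sym , w₂ _ _ θ⁺ θ⁺-sym) =
    record { θ⁻ = θ⁻ ; θ⁺ = θ⁺ ; θ⁻-sym = θ⁻-sym ; θ⁺-sym = θ⁺-sym ; factors = ≐₂-refl }

  split-cong : ∀ {u u′} → u ≈₁ u′ → split u ≈₂ split u′
  split-cong {u} {u′} (xσ≐ , θ≐) =
    let (θ⁻≐ , θ⁺≐) = factorisation-unique (W₁El.θ-sym u′)
          (factorisation-resp (image-cong ∂ xσ≐) θ≐ (factorisationOf u)) (factorisationOf u′)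
    in θ⁻≐ , xσ≐ , θ⁺≐

  join-cong : ∀ {v v′} → v ≈₂ v′ → join v ≈₁ join v′
  join-cong {_ , w₂ _ _ _ _} {_ , w₂ _ _ _ _} (θ⁻≐ , xσ≐ , θ⁺≐) = xσ≐ , ∘P-cong θ⁻≐ θ⁺≐

  split-join : ∀ {v u} → u ≈₁ join v → split u ≈₂ v
  split-join {v} {u} (xσ≐ , θ≐) =
    let (θ⁻≐ , θ⁺≐) = factorisation-unique (W₁El.θ-sym u) (factorisationOf u)
          (factorisation-resp (image-cong ∂ (≐-sym xσ≐)) (≐₂-sym θ≐) (joined v))
    in θ⁻≐ , xσ≐ , θ⁺≐

  join-split : ∀ {u v} → v ≈₂ split u → join v ≈₁ u
  join-split {u} {_ , w₂ _ _ _ _} (θ⁻≐ , xσ≐ , θ⁺≐) =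
    xσ≐ , ≐₂-trans (∘P-cong θ⁻≐ θ⁺≐) (≐₂-sym (factors (factorisationOf u)))

  W₁↔N×W₂ : Inverse (W₁ A σ x̂) (N×W₂ A σ x̂)
  W₁↔N×W₂ = record
    { to = split ; from = join
    ; to-cong = λ {u u′} → split-cong {u} {u′}
    ; from-cong = λ {v v′} → join-cong {v} {v′}
    ; inverse = (λ {v u} → split-join {v} {u}) , (λ {u v} → join-split {u} {v}) }

corollaryC7 : (A : Game) (σ : Strategy A) (x : Config (Game.E A))
              (complete : Game.κ A x ≡ 0ₚ) →
              Inverse (W₁ A σ (Game.canon A x complete))
                      (N×W₂ A σ (Game.canon A x complete))
corollaryC7 A σ x complete = W₁↔N×W₂ A σ (Game.canon-canonical A x complete)
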